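{- Let $k\geq 2$ be an integer and, for $n\geq 0$, let $b_{k,n}$ denote the number of odd-up words over $k$ of length $n$. Let $B_k(x)=\sum_{n\geq 0}b_{k,n}x^n$. Then \[B_k(x)=\frac{(x+1)^{\lfloor (k+1)/2\rfloor}}{x+2-(x+1)^{\lfloor (k+2)/2\rfloor}}.\]
   Context: For an integer $k\geq 2$, let $[k]=\{1,\ldots,k\}$. A word over $k$ of length $n$ is an element $w_1\cdots w_n\in[k]^n$ (for $n=0$ there is exactly one word, the empty word). A word $w_1\cdots w_n\in[k]^n$ is odd-up if for every $i\in[n-1]$, whenever $w_i$ is odd, $w_{i+1}>w_i$. -}

module Defs where

open import Data.Bool using (Bool; true; false; _∧_; if_then_else_)
open import Data.Nat as ℕ using (ℕ; zero; suc; _∸_; _/_; _%_; _≡ᵇ_; _<ᵇ_)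
open import Data.Nat.Combinatorics using (_C_)
open import Data.Integer as ℤ using (ℤ; +_; _-_)
open import Data.List using (List; []; _∷_; map; concatMap; upTo; length; filterᵇ)

letters : ℕ → List ℕ
letters k = map suc (upTo k)

words : ℕ → ℕ → List (List ℕ)
words k zero    = [] ∷ []
words k (suc n) = concatMap (λ a → map (a ∷_) (words k n)) (letters k)

oddUp : List ℕ → Bool
oddUp []            = true
oddUp (a ∷ [])      = true
oddUp (a ∷ b ∷ w)   = (if a % 2 ≡ᵇ 1 then a <ᵇ b else true) ∧ oddUp (b ∷ w)

b : ℕ → ℕ → ℕ
b k n = length (filterᵇ oddUp (words k n))

FPS : Set
FPS = ℕ → ℤ

sumℤ : ℕ → (ℕ → ℤ) → ℤ
sumℤ zero    f = + 0
sumℤ (suc m) f = sumℤ m f ℤ.+ f m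

_⋆_ : FPS → FPS → FPS
(f ⋆ g) n = sumℤ (suc n) (λ i → f i ℤ.* g (n ∸ i))

linear : ℤ → FPS
linear c zero          = c
linear c (suc zero)    = + 1
linear c (suc (suc _)) = + 0

onePlusXPow : ℕ → FPS
onePlusXPow m j = + (m C j)

B : ℕ → FPS
B k n = + (b k n)

den : ℕ → FPS
den k j = linear (+ 2) j - onePlusXPow ((k ℕ.+ 2) / 2) j

num : ℕ → FPS
num k = onePlusXPow ((k ℕ.+ 1) / 2)

{-# OPTIONS --safe #-}
module Submission where

-- Let A_t count the odd-up words whose first letter exceeds t (the empty word included),
-- so that A_0 = B_k and A_k = 1.  Splitting off a first letter t + 1 gives
-- A_t = (1 + x) A_{t+1} when t + 1 is odd (it must be followed by a larger letter) and
-- A_t = A_{t+1} + x B_k when t + 1 is even (it may be followed by anything).  Substituting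
-- these for t = 0, ..., k - 1 in turn, the terms x (1+x)^i B_k = ((1+x)^{i+1} - (1+x)^i) B_k
-- telescope, leaving (x + 2 - (1+x)^{⌊k/2⌋+1}) B_k = (1+x)^{⌈k/2⌉} A_k = (1+x)^{⌈k/2⌉}.

open import Defs
open import Data.Nat as ℕ using (ℕ; zero; suc; _∸_; _≤_; _<_; z≤n; s≤s)
open import Data.Nat.Properties using (≤-refl; <⇒≤; n≤1+n)
open import Relation.Binary.PropositionalEquality

module PowerSeries where

  open import Data.Integer using (ℤ; +_; _+_; _-_; _*_)
  open import Data.Integer.Properties
    using (+-identityˡ; +-identityʳ; *-identityʳ; *-zeroʳ; *-distribˡ-+; pos-+)
  open import Data.Integer.Tactic.RingSolver using (solve-∀)
  open import Data.Nat.Combinatorics using (_C_; nCk+nC[k+1]≡[n+1]C[k+1])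
  open import Data.Nat.GeneralisedArithmetic using (iterate)
  open import Data.Nat.Properties using (m<n⇒m<1+n; n<1+n; +-∸-assoc; n∸n≡0)

  infixl 6 _+ₛ_ _-ₛ_
  infixr 25 x*_ [1+x]*_ [1+x]^_*_ [x+2-[1+x]^_]*_

  private variable
    f g h : FPS

  _+ₛ_ _-ₛ_ : FPS → FPS → FPS
  (f +ₛ g) n = f n + g n
  (f -ₛ g) n = f n - g n

  one : FPS
  one zero    = + 1
  one (suc _) = + 0

  x*_ : FPS → FPS
  (x* f) zero    = + 0
  (x* f) (suc n) = f n

  [1+x]*_ : FPS → FPS
  [1+x]* f = x* f +ₛ f

  [1+x]^_*_ : ℕ → FPS → FPS
  [1+x]^ p * f = iterate [1+x]*_ f p

  [x+2-[1+x]^_]*_ : ℕ → FPS → FPS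
  [x+2-[1+x]^ q ]* f = (f +ₛ [1+x]* f) -ₛ [1+x]^ q * f

  x*-cong : f ≗ g → x* f ≗ x* g
  x*-cong f≗g zero    = refl
  x*-cong f≗g (suc n) = f≗g n

  [1+x]*-cong : f ≗ g → [1+x]* f ≗ [1+x]* g
  [1+x]*-cong f≗g n = cong₂ _+_ (x*-cong f≗g n) (f≗g n)

  [1+x]^-cong : ∀ p → f ≗ g → [1+x]^ p * f ≗ [1+x]^ p * g
  [1+x]^-cong zero    f≗g = f≗g
  [1+x]^-cong (suc p) f≗g = [1+x]^-cong p ([1+x]*-cong f≗g)

  private
    interchange : ∀ a b c d → (a + b) + (c + d) ≡ (a + c) + (b + d)
    interchange = solve-∀

  [1+x]*-distrib-+ₛ : ∀ f g → [1+x]* (f +ₛ g) ≗ [1+x]* f +ₛ [1+x]* g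
  [1+x]*-distrib-+ₛ f g zero    = interchange (+ 0) (+ 0) (f 0) (g 0)
  [1+x]*-distrib-+ₛ f g (suc n) = interchange (f n) (g n) (f (suc n)) (g (suc n))

  [1+x]^-distrib-+ₛ : ∀ p f g → [1+x]^ p * (f +ₛ g) ≗ [1+x]^ p * f +ₛ [1+x]^ p * g
  [1+x]^-distrib-+ₛ zero    f g n = refl
  [1+x]^-distrib-+ₛ (suc p) f g n =
    trans ([1+x]^-cong p ([1+x]*-distrib-+ₛ f g) n) ([1+x]^-distrib-+ₛ p ([1+x]* f) ([1+x]* g) n)

  [1+x]*-[1+x]^ : ∀ p f → [1+x]* [1+x]^ p * f ≗ [1+x]^ suc p * f
  [1+x]*-[1+x]^ zero    f n = refl
  [1+x]*-[1+x]^ (suc p) f n = [1+x]*-[1+x]^ p ([1+x]* f) n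

  onePlusXPow-zero : onePlusXPow 0 ≗ one
  onePlusXPow-zero zero    = refl
  onePlusXPow-zero (suc n) = refl

  onePlusXPow-suc : ∀ m → onePlusXPow (suc m) ≗ [1+x]* onePlusXPow m
  onePlusXPow-suc m zero    = refl
  onePlusXPow-suc m (suc j) =
    trans (cong +_ (sym (nCk+nC[k+1]≡[n+1]C[k+1] m j))) (pos-+ (m C j) (m C suc j))

  onePlusXPow≗[1+x]^ : ∀ m → onePlusXPow m ≗ [1+x]^ m * one
  onePlusXPow≗[1+x]^ zero    = onePlusXPow-zero
  onePlusXPow≗[1+x]^ (suc m) n = begin
    onePlusXPow (suc m) n      ≡⟨ onePlusXPow-suc m n ⟩
    ([1+x]* onePlusXPow m) n   ≡⟨ [1+x]*-cong (onePlusXPow≗[1+x]^ m) n ⟩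
    ([1+x]* [1+x]^ m * one) n  ≡⟨ [1+x]*-[1+x]^ m one n ⟩
    ([1+x]^ suc m * one) n     ∎
    where open ≡-Reasoning

  sumℤ-cong : ∀ m {f g : ℕ → ℤ} → (∀ i → i < m → f i ≡ g i) → sumℤ m f ≡ sumℤ m g
  sumℤ-cong zero    f≡g = refl
  sumℤ-cong (suc m) f≡g =
    cong₂ _+_ (sumℤ-cong m (λ i i<m → f≡g i (m<n⇒m<1+n i<m))) (f≡g m (n<1+n m))

  sumℤ-zeros : ∀ m {f : ℕ → ℤ} → (∀ i → i < m → f i ≡ + 0) → sumℤ m f ≡ + 0
  sumℤ-zeros m f≡0 = trans (sumℤ-cong m f≡0) (zeros m)
    where
    zeros : ∀ m → sumℤ m (λ _ → + 0) ≡ + 0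
    zeros zero    = refl
    zeros (suc m) = cong (_+ + 0) (zeros m)

  sumℤ-distrib-+ : ∀ m (f g : ℕ → ℤ) → sumℤ m (λ i → f i + g i) ≡ sumℤ m f + sumℤ m g
  sumℤ-distrib-+ zero    f g = refl
  sumℤ-distrib-+ (suc m) f g =
    trans (cong (_+ (f m + g m)) (sumℤ-distrib-+ m f g))
          (interchange (sumℤ m f) (sumℤ m g) (f m) (g m))

  sumℤ-distrib-- : ∀ m (f g : ℕ → ℤ) → sumℤ m (λ i → f i - g i) ≡ sumℤ m f - sumℤ m g
  sumℤ-distrib-- zero    f g = refl
  sumℤ-distrib-- (suc m) f g =
    trans (cong (_+ (f m - g m)) (sumℤ-distrib-- m f g))
          (interchange-- (sumℤ m f) (sumℤ m g) (f m) (g m))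
    where
    interchange-- : ∀ a b c d → (a - b) + (c - d) ≡ (a + c) - (b + d)
    interchange-- = solve-∀

  private
    suc∸ : ∀ {i n} → i < suc n → suc n ∸ i ≡ suc (n ∸ i)
    suc∸ (s≤s i≤n) = +-∸-assoc 1 i≤n

  ⋆-congˡ : ∀ f → g ≗ h → f ⋆ g ≗ f ⋆ h
  ⋆-congˡ f g≗h n = sumℤ-cong (suc n) (λ i _ → cong (f i *_) (g≗h (n ∸ i)))

  ⋆-distribˡ-+ₛ : ∀ f g h → f ⋆ (g +ₛ h) ≗ f ⋆ g +ₛ f ⋆ h
  ⋆-distribˡ-+ₛ f g h n =
    trans (sumℤ-cong (suc n) (λ i _ → *-distribˡ-+ (f i) (g (n ∸ i)) (h (n ∸ i))))
          (sumℤ-distrib-+ (suc n) _ _)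

  ⋆-distribˡ--ₛ : ∀ f g h → f ⋆ (g -ₛ h) ≗ f ⋆ g -ₛ f ⋆ h
  ⋆-distribˡ--ₛ f g h n =
    trans (sumℤ-cong (suc n) (λ i _ → distribˡ-- (f i) (g (n ∸ i)) (h (n ∸ i))))
          (sumℤ-distrib-- (suc n) _ _)
    where
    distribˡ-- : ∀ a b c → a * (b - c) ≡ a * b - a * c
    distribˡ-- = solve-∀

  ⋆-identityʳ : ∀ f → f ⋆ one ≗ f
  ⋆-identityʳ f zero    = trans (+-identityˡ _) (*-identityʳ (f 0))
  ⋆-identityʳ f (suc n) = begin
    sumℤ (suc n) (λ i → f i * one (suc n ∸ i)) + f (suc n) * one (n ∸ n)
      ≡⟨ cong₂ _+_ (sumℤ-zeros (suc n) vanish) (cong (λ j → f (suc n) * one j) (n∸n≡0 n)) ⟩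
    + 0 + f (suc n) * + 1
      ≡⟨ trans (+-identityˡ _) (*-identityʳ (f (suc n))) ⟩
    f (suc n) ∎
    where
    open ≡-Reasoning
    vanish : ∀ i → i < suc n → f i * one (suc n ∸ i) ≡ + 0
    vanish i i<1+n = trans (cong (λ j → f i * one j) (suc∸ i<1+n)) (*-zeroʳ (f i))

  ⋆-x* : ∀ f g → f ⋆ x* g ≗ x* (f ⋆ g)
  ⋆-x* f g zero    = trans (+-identityˡ _) (*-zeroʳ (f 0))
  ⋆-x* f g (suc n) = begin
    sumℤ (suc n) (λ i → f i * (x* g) (suc n ∸ i)) + f (suc n) * (x* g) (n ∸ n)
      ≡⟨ cong₂ _+_ (sumℤ-cong (suc n) shift) (cong (λ j → f (suc n) * (x* g) j) (n∸n≡0 n)) ⟩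
    (f ⋆ g) n + f (suc n) * + 0
      ≡⟨ trans (cong (λ z → (f ⋆ g) n + z) (*-zeroʳ (f (suc n)))) (+-identityʳ _) ⟩
    (f ⋆ g) n ∎
    where
    open ≡-Reasoning
    shift : ∀ i → i < suc n → f i * (x* g) (suc n ∸ i) ≡ f i * g (n ∸ i)
    shift i i<1+n = cong (λ j → f i * (x* g) j) (suc∸ i<1+n)

  ⋆-[1+x]* : ∀ f g → f ⋆ [1+x]* g ≗ [1+x]* (f ⋆ g)
  ⋆-[1+x]* f g n = trans (⋆-distribˡ-+ₛ f (x* g) g n) (cong (_+ (f ⋆ g) n) (⋆-x* f g n))

  ⋆-onePlusXPow : ∀ m f → f ⋆ onePlusXPow m ≗ [1+x]^ m * f
  ⋆-onePlusXPow zero    f n = trans (⋆-congˡ f onePlusXPow-zero n) (⋆-identityʳ f n)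
  ⋆-onePlusXPow (suc m) f n = begin
    (f ⋆ onePlusXPow (suc m)) n     ≡⟨ ⋆-congˡ f (onePlusXPow-suc m) n ⟩
    (f ⋆ [1+x]* onePlusXPow m) n    ≡⟨ ⋆-[1+x]* f (onePlusXPow m) n ⟩
    ([1+x]* (f ⋆ onePlusXPow m)) n  ≡⟨ [1+x]*-cong (⋆-onePlusXPow m f) n ⟩
    ([1+x]* [1+x]^ m * f) n         ≡⟨ [1+x]*-[1+x]^ m f n ⟩
    ([1+x]^ suc m * f) n            ∎
    where open ≡-Reasoning

  x+2≗one+[1+x]*one : linear (+ 2) ≗ one +ₛ [1+x]* one
  x+2≗one+[1+x]*one zero          = refl
  x+2≗one+[1+x]*one (suc zero)    = refl
  x+2≗one+[1+x]*one (suc (suc n)) = refl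

  ⋆-x+2-[1+x]^ : ∀ q f → f ⋆ (linear (+ 2) -ₛ onePlusXPow q) ≗ [x+2-[1+x]^ q ]* f
  ⋆-x+2-[1+x]^ q f n = begin
    (f ⋆ (linear (+ 2) -ₛ onePlusXPow q)) n
      ≡⟨ ⋆-distribˡ--ₛ f (linear (+ 2)) (onePlusXPow q) n ⟩
    (f ⋆ linear (+ 2)) n - (f ⋆ onePlusXPow q) n
      ≡⟨ cong₂ _-_ ⋆-x+2 (⋆-onePlusXPow q f n) ⟩
    ([x+2-[1+x]^ q ]* f) n ∎
    where
    open ≡-Reasoning
    ⋆-x+2 : (f ⋆ linear (+ 2)) n ≡ f n + ([1+x]* f) n
    ⋆-x+2 = begin
      (f ⋆ linear (+ 2)) n                ≡⟨ ⋆-congˡ f x+2≗one+[1+x]*one n ⟩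
      (f ⋆ (one +ₛ [1+x]* one)) n         ≡⟨ ⋆-distribˡ-+ₛ f one ([1+x]* one) n ⟩
      (f ⋆ one) n + (f ⋆ [1+x]* one) n    ≡⟨ cong (λ z → (f ⋆ one) n + z) (⋆-[1+x]* f one n) ⟩
      (f ⋆ one) n + ([1+x]* (f ⋆ one)) n  ≡⟨ cong₂ _+_ (⋆-identityʳ f n)
                                                       ([1+x]*-cong (⋆-identityʳ f) n) ⟩
      f n + ([1+x]* f) n                  ∎

module OddUpCounting where

  open import Data.Bool using (Bool; true; false; _∧_; if_then_else_)
  open import Data.List using (List; []; _∷_; _++_; map; concatMap; upTo; length; filterᵇ)
  open import Data.List.Properties using (filter-++; length-++; map-++; map-∘; map-cong; upTo-∷ʳ)
  open import Data.Nat using (_+_; _%_; _<ᵇ_)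
  open import Data.Nat.ListAction using (sum)
  open import Data.Nat.ListAction.Properties using (sum-++)
  open import Data.Nat.Properties using (+-identityʳ; +-assoc; m≤n⇒m<n∨m≡n)
  open import Data.Sum using (inj₁; inj₂)
  open import Function using (_∘_)
  open import Relation.Nullary.Decidable using (T?)

  private variable
    X Y : Set
    p q : X → Bool

  count : (X → Bool) → List X → ℕ
  count p xs = length (filterᵇ p xs)

  count-++ : ∀ (p : X → Bool) xs ys → count p (xs ++ ys) ≡ count p xs + count p ys
  count-++ p xs ys = trans (cong length (filter-++ (T? ∘ p) xs ys)) (length-++ (filterᵇ p xs))

  count-map : ∀ (p : Y → Bool) (f : X → Y) xs → count p (map f xs) ≡ count (p ∘ f) xs
  count-map p f []       = refl
  count-map p f (x ∷ xs) with p (f x)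
  ... | true  = cong suc (count-map p f xs)
  ... | false = count-map p f xs

  count-cong : (∀ x → p x ≡ q x) → ∀ (xs : List X) → count p xs ≡ count q xs
  count-cong p≡q []       = refl
  count-cong {p = p} {q} p≡q (x ∷ xs) with p x | q x | p≡q x
  ... | true  | true  | refl = cong suc (count-cong p≡q xs)
  ... | false | false | refl = count-cong p≡q xs

  count-const-∧ : ∀ c (p : X → Bool) xs → count (λ x → c ∧ p x) xs ≡ (if c then count p xs else 0)
  count-const-∧ true  p xs = refl
  count-const-∧ false p xs = none xs
    where
    none : ∀ (xs : List X) → count (λ _ → false) xs ≡ 0
    none []       = refl
    none (x ∷ xs) = none xs

  count-concatMap : ∀ (p : Y → Bool) (f : X → List Y) xs →
                    count p (concatMap f xs) ≡ sum (map (count p ∘ f) xs)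
  count-concatMap p f []       = refl
  count-concatMap p f (x ∷ xs) =
    trans (count-++ p (f x) (concatMap f xs)) (cong (count p (f x) +_) (count-concatMap p f xs))

  count-words-suc : ∀ (p : List ℕ → Bool) k n →
    count p (words k (suc n)) ≡ sum (map (λ a → count (λ w → p (a ∷ w)) (words k n)) (letters k))
  count-words-suc p k n =
    trans (count-concatMap p (λ a → map (a ∷_) (words k n)) (letters k))
          (cong sum (map-cong (λ a → count-map p (a ∷_) (words k n)) (letters k)))

  letters-suc : ∀ k → letters (suc k) ≡ letters k ++ suc k ∷ []
  letters-suc k = trans (cong (map suc) (sym (upTo-∷ʳ k))) (map-++ suc (upTo k) (k ∷ []))

  onlyAbove : ℕ → (ℕ → ℕ) → ℕ → ℕ
  onlyAbove t h a = if t <ᵇ a then h a else 0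

  sumAbove : ℕ → (ℕ → ℕ) → ℕ → ℕ
  sumAbove k h t = sum (map (onlyAbove t h) (letters k))

  private
    sumAbove-suc : ∀ k h t → sumAbove (suc k) h t ≡ sumAbove k h t + onlyAbove t h (suc k)
    sumAbove-suc k h t = begin
      sum (map g (letters (suc k)))              ≡⟨ cong (sum ∘ map g) (letters-suc k) ⟩
      sum (map g (letters k ++ suc k ∷ []))      ≡⟨ cong sum (map-++ g (letters k) (suc k ∷ [])) ⟩
      sum (map g (letters k) ++ g (suc k) ∷ [])  ≡⟨ sum-++ (map g (letters k)) (g (suc k) ∷ []) ⟩
      sumAbove k h t + (g (suc k) + 0)           ≡⟨ cong (sumAbove k h t +_) (+-identityʳ (g (suc k))) ⟩
      sumAbove k h t + g (suc k)                 ∎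
      where
      open ≡-Reasoning
      g : ℕ → ℕ
      g = onlyAbove t h

    onlyAbove-< : ∀ {t a} h → t < a → onlyAbove t h a ≡ h a
    onlyAbove-< {zero}  {suc a} h _         = refl
    onlyAbove-< {suc t} {suc a} h (s≤s t<a) = onlyAbove-< (h ∘ suc) t<a

    onlyAbove-≥ : ∀ {t a} h → a ≤ t → onlyAbove t h a ≡ 0
    onlyAbove-≥ {a = zero}  h _         = refl
    onlyAbove-≥ {a = suc a} h (s≤s a≤t) = onlyAbove-≥ (h ∘ suc) a≤t

  sumAbove-suc-< : ∀ k h {t} → t < suc k → sumAbove (suc k) h t ≡ sumAbove k h t + h (suc k)
  sumAbove-suc-< k h {t} t<1+k = trans (sumAbove-suc k h t) (cong (sumAbove k h t +_) (onlyAbove-< h t<1+k))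

  sumAbove-suc-≥ : ∀ k h {t} → suc k ≤ t → sumAbove (suc k) h t ≡ sumAbove k h t
  sumAbove-suc-≥ k h {t} k<t = begin
    sumAbove (suc k) h t                    ≡⟨ sumAbove-suc k h t ⟩
    sumAbove k h t + onlyAbove t h (suc k)  ≡⟨ cong (sumAbove k h t +_) (onlyAbove-≥ h k<t) ⟩
    sumAbove k h t + 0                      ≡⟨ +-identityʳ (sumAbove k h t) ⟩
    sumAbove k h t                          ∎
    where open ≡-Reasoning

  sumAbove-≥ : ∀ k h {t} → k ≤ t → sumAbove k h t ≡ 0
  sumAbove-≥ zero    h k≤t = refl
  sumAbove-≥ (suc k) h k<t = trans (sumAbove-suc-≥ k h k<t) (sumAbove-≥ k h (<⇒≤ k<t))

  sumAbove-< : ∀ k h {t} → t < k → sumAbove k h t ≡ h (suc t) + sumAbove k h (suc t)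
  sumAbove-< (suc k) h {t} t<1+k@(s≤s t≤k) with m≤n⇒m<n∨m≡n t≤k
  ... | inj₁ t<k = begin
    sumAbove (suc k) h t                            ≡⟨ sumAbove-suc-< k h t<1+k ⟩
    sumAbove k h t + h (suc k)                      ≡⟨ cong (_+ h (suc k)) (sumAbove-< k h t<k) ⟩
    h (suc t) + sumAbove k h (suc t) + h (suc k)    ≡⟨ +-assoc (h (suc t)) _ _ ⟩
    h (suc t) + (sumAbove k h (suc t) + h (suc k))  ≡⟨ cong (h (suc t) +_) (sumAbove-suc-< k h (s≤s t<k)) ⟨
    h (suc t) + sumAbove (suc k) h (suc t)          ∎
    where open ≡-Reasoning
  ... | inj₂ refl = begin
    sumAbove (suc t) h t                            ≡⟨ sumAbove-suc-< t h t<1+k ⟩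
    sumAbove t h t + h (suc t)                      ≡⟨ cong (_+ h (suc t)) (sumAbove-≥ t h ≤-refl) ⟩
    h (suc t)                                       ≡⟨ +-identityʳ (h (suc t)) ⟨
    h (suc t) + 0                                   ≡⟨ cong (h (suc t) +_)
                                                           (sumAbove-≥ (suc t) h ≤-refl) ⟨
    h (suc t) + sumAbove (suc t) h (suc t)          ∎
    where open ≡-Reasoning

  startsAbove : ℕ → List ℕ → Bool
  startsAbove t []      = true
  startsAbove t (a ∷ _) = t <ᵇ a

  oddUpAbove : ℕ → ℕ → ℕ → ℕ
  oddUpAbove k n t = count (λ w → startsAbove t w ∧ oddUp w) (words k n)

  oddUpAfter : ℕ → ℕ → ℕ → ℕ
  oddUpAfter k n a = count (λ w → oddUp (a ∷ w)) (words k n)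

  oddUp-∷-odd : ∀ {a} w → a % 2 ≡ 1 → oddUp (a ∷ w) ≡ startsAbove a w ∧ oddUp w
  oddUp-∷-odd []      a-odd = refl
  oddUp-∷-odd (c ∷ w) a-odd rewrite a-odd = refl

  oddUp-∷-even : ∀ {a} w → a % 2 ≡ 0 → oddUp (a ∷ w) ≡ oddUp w
  oddUp-∷-even []      a-even = refl
  oddUp-∷-even (c ∷ w) a-even rewrite a-even = refl

  oddUpAfter-odd : ∀ k n {a} → a % 2 ≡ 1 → oddUpAfter k n a ≡ oddUpAbove k n a
  oddUpAfter-odd k n a-odd = count-cong (λ w → oddUp-∷-odd w a-odd) (words k n)

  oddUpAfter-even : ∀ k n {a} → a % 2 ≡ 0 → oddUpAfter k n a ≡ b k n
  oddUpAfter-even k n a-even = count-cong (λ w → oddUp-∷-even w a-even) (words k n)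

  oddUpAbove-suc : ∀ k n t → oddUpAbove k (suc n) t ≡ sumAbove k (oddUpAfter k n) t
  oddUpAbove-suc k n t =
    trans (count-words-suc (λ w → startsAbove t w ∧ oddUp w) k n)
          (cong sum (map-cong (λ a → count-const-∧ (t <ᵇ a) (λ w → oddUp (a ∷ w)) (words k n))
                              (letters k)))

  oddUpAbove-suc-≥ : ∀ k n {t} → k ≤ t → oddUpAbove k (suc n) t ≡ 0
  oddUpAbove-suc-≥ k n {t} k≤t = trans (oddUpAbove-suc k n t) (sumAbove-≥ k (oddUpAfter k n) k≤t)

  oddUpAbove-suc-< : ∀ k n {t} → t < k →
                     oddUpAbove k (suc n) t ≡ oddUpAfter k n (suc t) + oddUpAbove k (suc n) (suc t)
  oddUpAbove-suc-< k n {t} t<k = begin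
    oddUpAbove k (suc n) t                                        ≡⟨ oddUpAbove-suc k n t ⟩
    sumAbove k (oddUpAfter k n) t                                 ≡⟨ sumAbove-< k (oddUpAfter k n) t<k ⟩
    oddUpAfter k n (suc t) + sumAbove k (oddUpAfter k n) (suc t)  ≡⟨ cong (oddUpAfter k n (suc t) +_)
                                                                          (oddUpAbove-suc k n (suc t)) ⟨
    oddUpAfter k n (suc t) + oddUpAbove k (suc n) (suc t)         ∎
    where open ≡-Reasoning

  oddUpAbove-zero : ∀ k n → oddUpAbove k n 0 ≡ b k n
  oddUpAbove-zero k zero    = refl
  oddUpAbove-zero k (suc n) = begin
    oddUpAbove k (suc n) 0                                         ≡⟨ oddUpAbove-suc k n 0 ⟩
    sum (map (onlyAbove 0 (oddUpAfter k n)) (map suc (upTo k)))    ≡⟨ cong sum (map-∘ (upTo k)) ⟨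
    sum (map (oddUpAfter k n ∘ suc) (upTo k))                      ≡⟨ cong sum (map-∘ (upTo k)) ⟩
    sum (map (oddUpAfter k n) (letters k))                         ≡⟨ count-words-suc oddUp k n ⟨
    b k (suc n)                                                    ∎
    where open ≡-Reasoning

module Halving where

  open import Data.Nat using (_+_; _*_; _/_; ⌊_/2⌋; ⌈_/2⌉)
  open import Data.Nat.DivMod using (m/n≡1+[m∸n]/n)
  open import Data.Nat.Properties using (+-comm)

  data Parity : ℕ → Set where
    even : ∀ j → Parity (j * 2)
    odd  : ∀ j → Parity (suc (j * 2))

  parity : ∀ n → Parity n
  parity zero = even 0
  parity (suc n) with parity n
  ... | even j = odd j
  ... | odd j  = even (suc j)

  ⌊j*2/2⌋≡j : ∀ j → ⌊ j * 2 /2⌋ ≡ j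
  ⌊j*2/2⌋≡j zero    = refl
  ⌊j*2/2⌋≡j (suc j) = cong suc (⌊j*2/2⌋≡j j)

  ⌈j*2/2⌉≡j : ∀ j → ⌈ j * 2 /2⌉ ≡ j
  ⌈j*2/2⌉≡j zero    = refl
  ⌈j*2/2⌉≡j (suc j) = cong suc (⌈j*2/2⌉≡j j)

  n/2≡⌊n/2⌋ : ∀ n → n / 2 ≡ ⌊ n /2⌋
  n/2≡⌊n/2⌋ zero          = refl
  n/2≡⌊n/2⌋ (suc zero)    = refl
  n/2≡⌊n/2⌋ (suc (suc n)) =
    trans (m/n≡1+[m∸n]/n {suc (suc n)} (s≤s (s≤s z≤n))) (cong suc (n/2≡⌊n/2⌋ n))

  [n+1]/2≡⌈n/2⌉ : ∀ n → (n + 1) / 2 ≡ ⌈ n /2⌉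
  [n+1]/2≡⌈n/2⌉ n = trans (cong (_/ 2) (+-comm n 1)) (n/2≡⌊n/2⌋ (suc n))

  [n+2]/2≡1+⌊n/2⌋ : ∀ n → (n + 2) / 2 ≡ suc ⌊ n /2⌋
  [n+2]/2≡1+⌊n/2⌋ n = trans (cong (_/ 2) (+-comm n 2)) (n/2≡⌊n/2⌋ (2 + n))

open PowerSeries
open OddUpCounting
open Halving
open import Data.Integer using (ℤ; +_; _+_; _-_)
open import Data.Integer.Properties using (pos-+)
open import Data.Integer.Tactic.RingSolver using (solve-∀)
open import Data.Nat using (_*_; _%_; ⌊_/2⌋; ⌈_/2⌉)
open import Data.Nat.DivMod using ([m+kn]%n≡m%n; m*n%n≡0)

Above After : ℕ → ℕ → FPS
Above k t n = + oddUpAbove k n t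
After k a n = + oddUpAfter k n a

module _ (k : ℕ) where

  Above-zero : Above k 0 ≗ B k
  Above-zero n = cong +_ (oddUpAbove-zero k n)

  Above-top : Above k k ≗ one
  Above-top zero    = refl
  Above-top (suc n) = cong +_ (oddUpAbove-suc-≥ k n ≤-refl)

  Above-step : ∀ {t} → t < k → Above k t ≗ x* After k (suc t) +ₛ Above k (suc t)
  Above-step t<k zero    = refl
  Above-step {t} t<k (suc n) =
    trans (cong +_ (oddUpAbove-suc-< k n t<k)) (pos-+ (oddUpAfter k n (suc t)) (oddUpAbove k (suc n) (suc t)))

  After-odd : ∀ {a} → a % 2 ≡ 1 → After k a ≗ Above k a
  After-odd a-odd n = cong +_ (oddUpAfter-odd k n a-odd)

  After-even : ∀ {a} → a % 2 ≡ 0 → After k a ≗ B k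
  After-even a-even n = cong +_ (oddUpAfter-even k n a-even)

  Above-step-odd : ∀ {t} → suc t % 2 ≡ 1 → t < k → Above k t ≗ [1+x]* Above k (suc t)
  Above-step-odd {t} 1+t-odd t<k n =
    trans (Above-step t<k n) (cong (_+ Above k (suc t) n) (x*-cong (After-odd 1+t-odd) n))

  Above-step-even : ∀ {t} → suc t % 2 ≡ 0 → t < k → Above k t ≗ x* B k +ₛ Above k (suc t)
  Above-step-even {t} 1+t-even t<k n =
    trans (Above-step t<k n) (cong (_+ Above k (suc t) n) (x*-cong (After-even 1+t-even) n))

  Telescope : ℕ → ℕ → ℕ → Set
  Telescope t p q = [x+2-[1+x]^ q ]* B k ≗ [1+x]^ p * Above k t

  telescope-start : Telescope 0 0 1
  telescope-start n = trans (cancel (B k n) (([1+x]* B k) n)) (sym (Above-zero n))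
    where
    cancel : ∀ a c → (a + c) - c ≡ a
    cancel = solve-∀

  telescope-odd : ∀ {t p q} → suc t % 2 ≡ 1 → t < k → Telescope t p q → Telescope (suc t) (suc p) q
  telescope-odd {p = p} 1+t-odd t<k tele n = trans (tele n) ([1+x]^-cong p (Above-step-odd 1+t-odd t<k) n)

  telescope-even : ∀ {t p} → suc t % 2 ≡ 0 → t < k → Telescope t p p → Telescope (suc t) p (suc p)
  telescope-even {t} {p} 1+t-even t<k tele n = begin
    ([x+2-[1+x]^ suc p ]* B k) n  ≡⟨ cong (s -_) ([1+x]^-distrib-+ₛ p (x* B k) (B k) n) ⟩
    s - (u + v)                   ≡⟨ move s u v ⟩
    (s - v) - u                   ≡⟨ cong (_- u) split ⟩
    (u + w) - u                   ≡⟨ cancel u w ⟩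
    w                             ∎
    where
    open ≡-Reasoning
    s u v w : ℤ
    s = (B k +ₛ [1+x]* B k) n
    u = ([1+x]^ p * x* B k) n
    v = ([1+x]^ p * B k) n
    w = ([1+x]^ p * Above k (suc t)) n
    split : s - v ≡ u + w
    split = begin
      s - v                                       ≡⟨ tele n ⟩
      ([1+x]^ p * Above k t) n                    ≡⟨ [1+x]^-cong p (Above-step-even 1+t-even t<k) n ⟩
      ([1+x]^ p * (x* B k +ₛ Above k (suc t))) n  ≡⟨ [1+x]^-distrib-+ₛ p (x* B k) (Above k (suc t)) n ⟩
      u + w                                       ∎
    move : ∀ s u v → s - (u + v) ≡ (s - v) - u
    move = solve-∀
    cancel : ∀ u w → (u + w) - u ≡ w
    cancel = solve-∀

  telescope-even-length : ∀ j → j * 2 ≤ k → Telescope (j * 2) j (suc j)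
  telescope-even-length zero    _ = telescope-start
  telescope-even-length (suc j) 2j+2≤k =
    telescope-even {p = suc j} (m*n%n≡0 (suc j) 2) 2j+2≤k
      (telescope-odd {p = j} {q = suc j} ([m+kn]%n≡m%n 1 j 2) 2j+1≤k
        (telescope-even-length j (<⇒≤ 2j+1≤k)))
    where
    2j+1≤k : suc (j * 2) ≤ k
    2j+1≤k = <⇒≤ 2j+2≤k

telescope : ∀ k → Telescope k k ⌈ k /2⌉ (suc ⌊ k /2⌋)
telescope k with parity k
... | even j rewrite ⌈j*2/2⌉≡j j | ⌊j*2/2⌋≡j j = telescope-even-length (j * 2) j ≤-refl
... | odd j  rewrite ⌈j*2/2⌉≡j j | ⌊j*2/2⌋≡j j =
  telescope-odd (suc (j * 2)) {p = j} {q = suc j} ([m+kn]%n≡m%n 1 j 2) ≤-refl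
    (telescope-even-length (suc (j * 2)) j (n≤1+n _))

theorem2 : (k : ℕ) → 2 ≤ k → (n : ℕ) → (B k ⋆ den k) n ≡ num k n
theorem2 k _ n = begin
  (B k ⋆ den k) n                         ≡⟨ ⋆-x+2-[1+x]^ ((k ℕ.+ 2) ℕ./ 2) (B k) n ⟩
  ([x+2-[1+x]^ (k ℕ.+ 2) ℕ./ 2 ]* B k) n  ≡⟨ cong (λ q → ([x+2-[1+x]^ q ]* B k) n) ([n+2]/2≡1+⌊n/2⌋ k) ⟩
  ([x+2-[1+x]^ suc ⌊ k /2⌋ ]* B k) n      ≡⟨ telescope k n ⟩
  ([1+x]^ ⌈ k /2⌉ * Above k k) n          ≡⟨ [1+x]^-cong ⌈ k /2⌉ (Above-top k) n ⟩
  ([1+x]^ ⌈ k /2⌉ * one) n                ≡⟨ onePlusXPow≗[1+x]^ ⌈ k /2⌉ n ⟨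
  onePlusXPow ⌈ k /2⌉ n                   ≡⟨ cong (λ p → onePlusXPow p n) ([n+1]/2≡⌈n/2⌉ k) ⟨
  num k n                                 ∎
  where open ≡-Reasoning
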